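{- Vertex covers can be taught in $O(n^2)$ rounds: for every graph $G$ with vertex set $V=\{1,\dots,n\}$ there exist a set $P_G$ of positive examples and a set $N_G$ of negative examples for the vertex cover concept with $|P_G|+|N_G|=O(n^2)$, such that every graph $H$ on $V$ consistent with these examples has exactly the same vertex covers as $G$.
   Context: A vertex cover of $G$ is a set of vertices containing at least one endpoint of every edge. Teaching model: for a vertex set concept $\Phi$ and a graph $G$ on $V$, a positive example is a set $V'\subseteq V$ with $\Phi(G,V')$ true, and a negative example is a set $V'\subseteq V$ with $\Phi(G,V')$ false. A graph $H$ on $V$ is consistent with example sets $P,N$ if $\Phi(H,V')$ holds for every $V'\in P$ and fails for every $V'\in N$. The concept can be taught in $g(n)$ rounds if, for every graph $G$ of order $n$, there exist $P_G,N_G$ with $|P_G|+|N_G|\le g(n)$ such that every graph $H$ on $V$ consistent with $P_G,N_G$ is $\Phi$-equivalent to $G$, i.e. $\{V':\Phi(H,V')\}=\{V':\Phi(G,V')\}$. -}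

module Defs where

open import Data.Nat using (ℕ)
open import Data.Bool using (Bool; true; false)
open import Data.Fin using (Fin)
open import Data.Fin.Subset using (Subset; _∈_)
open import Data.Sum using (_⊎_)
open import Data.Product using (_×_)
open import Data.List using (List)
open import Data.List.Relation.Unary.All using (All)
open import Relation.Nullary using (¬_)
open import Relation.Binary.PropositionalEquality using (_≡_)

record Graph (n : ℕ) : Set where
  field
    adj     : Fin n → Fin n → Bool
    sym     : ∀ u v → adj u v ≡ adj v u
    irrefl  : ∀ v → adj v v ≡ false
open Graph public

IsVertexCover : ∀ {n} → Graph n → Subset n → Set
IsVertexCover G S = ∀ u v → adj G u v ≡ true → (u ∈ S) ⊎ (v ∈ S)

Consistent : ∀ {n} → Graph n → List (Subset n) → List (Subset n) → Set
Consistent H P N =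
  All (IsVertexCover H) P × All (λ S → ¬ IsVertexCover H S) N

VC-Equivalent : ∀ {n} → Graph n → Graph n → Set
VC-Equivalent G H =
  ∀ S → (IsVertexCover G S → IsVertexCover H S) × (IsVertexCover H S → IsVertexCover G S)

-- The set V ∖ {u, v} misses only the edges inside {u, v}, so it is a vertex
-- cover exactly when uv is not an edge. Labelling each of the n² sets
-- V ∖ {u, v} positive or negative according to G therefore pins down the edge
-- set of every consistent graph, and graphs with the same edges have the same
-- vertex covers.
{-# OPTIONS --safe #-}
module Submission where

open import Defs
open import Data.Nat using (ℕ; _+_; _*_; _≤_; suc)
open import Data.Nat.Properties using (+-suc; +-comm; *-identityˡ; ≤-reflexive)
open import Data.Bool using (true; false)
open import Data.Bool.Properties using (_≟_)
open import Data.Fin using (Fin)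
open import Data.Fin.Subset using (Subset; _∉_; ⁅_⁆; _∪_; ∁)
open import Data.Fin.Subset.Properties
  using (_∈?_; x∈⁅x⁆; x∈⁅y⁆⇒x≡y; x∈p∪q⁺; x∈p∪q⁻; x∈p⇒x∉∁p; x∉∁p⇒x∈p)
open import Data.Product using (Σ; _×_; _,_; uncurry)
open import Data.Sum using (_⊎_; inj₁; inj₂; [_,_]′)
import Data.Sum as Sum
open import Data.List using (List; []; _∷_; _++_; length; map; filter; cartesianProduct; allFin)
open import Data.List.Properties using (length-map; length-++; length-tabulate)
open import Data.List.Membership.Propositional using () renaming (_∈_ to _∈ₗ_)
open import Data.List.Membership.Propositional.Properties
  using (∈-map⁺; ∈-filter⁺; ∈-cartesianProduct⁺; ∈-allFin)
open import Data.List.Relation.Unary.All using (All)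
import Data.List.Relation.Unary.All as All
open import Data.List.Relation.Unary.All.Properties using (all-filter; map⁺)
open import Level using (0ℓ)
open import Relation.Nullary using (¬_; contradiction; does; yes; no)
open import Relation.Nullary.Decidable using (decidable-stable)
open import Relation.Unary using (Pred; Decidable)
open import Relation.Unary.Properties using (∁?)
open import Relation.Binary.PropositionalEquality using (_≡_; _≢_; refl; trans; cong; cong₂)
import Relation.Binary.PropositionalEquality as ≡
open ≡.≡-Reasoning

module _ {a p} {A : Set a} {P : Pred A p} (P? : Decidable P) where

  length-filter+length-filter-∁ :
    ∀ xs → length (filter P? xs) + length (filter (∁? P?) xs) ≡ length xs
  length-filter+length-filter-∁ []       = refl
  length-filter+length-filter-∁ (x ∷ xs) with ih ← length-filter+length-filter-∁ xs | does (P? x)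
  ... | true  = cong suc ih
  ... | false = trans (+-suc _ _) (cong suc ih)

module _ {a b} {A : Set a} {B : Set b} where

  length-cartesianProduct :
    ∀ (xs : List A) (ys : List B) → length (cartesianProduct xs ys) ≡ length xs * length ys
  length-cartesianProduct []       ys = refl
  length-cartesianProduct (x ∷ xs) ys = begin
    length (map (x ,_) ys ++ cartesianProduct xs ys)
      ≡⟨ length-++ (map (x ,_) ys) ⟩
    length (map (x ,_) ys) + length (cartesianProduct xs ys)
      ≡⟨ cong₂ _+_ (length-map (x ,_) ys) (length-cartesianProduct xs ys) ⟩
    length ys + length xs * length ys
      ∎

module _ {n : ℕ} where

  ∁⁅_,_⁆ : Fin n → Fin n → Subset n
  ∁⁅ u , v ⁆ = ∁ (⁅ u ⁆ ∪ ⁅ v ⁆)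

  u∉∁⁅u,v⁆ : ∀ {u v} → u ∉ ∁⁅ u , v ⁆
  u∉∁⁅u,v⁆ {u} = x∈p⇒x∉∁p (x∈p∪q⁺ (inj₁ (x∈⁅x⁆ u)))

  v∉∁⁅u,v⁆ : ∀ {u v} → v ∉ ∁⁅ u , v ⁆
  v∉∁⁅u,v⁆ {v = v} = x∈p⇒x∉∁p (x∈p∪q⁺ (inj₂ (x∈⁅x⁆ v)))

  x∉∁⁅u,v⁆⇒x≡u⊎x≡v : ∀ {u v x} → x ∉ ∁⁅ u , v ⁆ → x ≡ u ⊎ x ≡ v
  x∉∁⁅u,v⁆⇒x≡u⊎x≡v {u} {v} x∉ =
    Sum.map (x∈⁅y⁆⇒x≡y u) (x∈⁅y⁆⇒x≡y v) (x∈p∪q⁻ ⁅ u ⁆ ⁅ v ⁆ (x∉∁p⇒x∈p x∉))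

  allPairs : List (Fin n × Fin n)
  allPairs = cartesianProduct (allFin n) (allFin n)

  length-allPairs : length allPairs ≡ n * n
  length-allPairs = begin
    length allPairs                          ≡⟨ length-cartesianProduct (allFin n) (allFin n) ⟩
    length (allFin n) * length (allFin n)   ≡⟨ cong₂ _*_ (length-tabulate {n = n} _) (length-tabulate {n = n} _) ⟩
    n * n                                    ∎

  ∈-allPairs : ∀ {u v} → (u , v) ∈ₗ allPairs
  ∈-allPairs {u} {v} = ∈-cartesianProduct⁺ (∈-allFin u) (∈-allFin v)

  Edge : Graph n → Pred (Fin n × Fin n) 0ℓ
  Edge G (u , v) = adj G u v ≡ true

  edge? : (G : Graph n) → Decidable (Edge G)
  edge? G (u , v) = adj G u v ≟ true

  _⊆ᴱ_ : Graph n → Graph n → Set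
  H ⊆ᴱ G = ∀ u v → adj H u v ≡ true → adj G u v ≡ true

  no-loop : ∀ (G : Graph n) {v} → adj G v v ≢ true
  no-loop G {v} vv = contradiction (trans (≡.sym vv) (irrefl G v)) λ ()

  edge-within-⁅u,v⁆ : ∀ (G : Graph n) {u v a b} →
    a ≡ u ⊎ a ≡ v → b ≡ u ⊎ b ≡ v → adj G a b ≡ true → adj G u v ≡ true
  edge-within-⁅u,v⁆ G (inj₁ refl) (inj₂ refl) ab = ab
  edge-within-⁅u,v⁆ G (inj₂ refl) (inj₁ refl) ab = trans (sym G _ _) ab
  edge-within-⁅u,v⁆ G (inj₁ refl) (inj₁ refl) ab = contradiction ab (no-loop G)
  edge-within-⁅u,v⁆ G (inj₂ refl) (inj₂ refl) ab = contradiction ab (no-loop G)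

  ∁⁅u,v⁆-cover⇒non-edge : ∀ (G : Graph n) {u v} →
    IsVertexCover G ∁⁅ u , v ⁆ → adj G u v ≢ true
  ∁⁅u,v⁆-cover⇒non-edge G {u} {v} cover uv = [ u∉∁⁅u,v⁆ , v∉∁⁅u,v⁆ ]′ (cover u v uv)

  non-edge⇒∁⁅u,v⁆-cover : ∀ (G : Graph n) {u v} →
    adj G u v ≢ true → IsVertexCover G ∁⁅ u , v ⁆
  non-edge⇒∁⁅u,v⁆-cover G {u} {v} ¬uv a b ab with a ∈? ∁⁅ u , v ⁆ | b ∈? ∁⁅ u , v ⁆
  ... | yes a∈ | _      = inj₁ a∈
  ... | no _   | yes b∈ = inj₂ b∈
  ... | no a∉  | no b∉  =
    contradiction (edge-within-⁅u,v⁆ G (x∉∁⁅u,v⁆⇒x≡u⊎x≡v a∉) (x∉∁⁅u,v⁆⇒x≡u⊎x≡v b∉) ab) ¬uv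

  cover-antitone : ∀ (G H : Graph n) → H ⊆ᴱ G → ∀ S → IsVertexCover G S → IsVertexCover H S
  cover-antitone G H H⊆G S cover a b ab = cover a b (H⊆G a b ab)

  same-edges⇒VC-Equivalent : ∀ (G H : Graph n) → H ⊆ᴱ G → G ⊆ᴱ H → VC-Equivalent G H
  same-edges⇒VC-Equivalent G H H⊆G G⊆H S = cover-antitone G H H⊆G S , cover-antitone H G G⊆H S

  module _ (G : Graph n) where

    edges nonEdges : List (Fin n × Fin n)
    edges    = filter (edge? G) allPairs
    nonEdges = filter (∁? (edge? G)) allPairs

    positiveExamples negativeExamples : List (Subset n)
    positiveExamples = map (uncurry ∁⁅_,_⁆) nonEdges
    negativeExamples = map (uncurry ∁⁅_,_⁆) edges

    length-examples : length positiveExamples + length negativeExamples ≡ n * n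
    length-examples = begin
      length positiveExamples + length negativeExamples
        ≡⟨ cong₂ _+_ (length-map _ nonEdges) (length-map _ edges) ⟩
      length nonEdges + length edges
        ≡⟨ +-comm (length nonEdges) (length edges) ⟩
      length edges + length nonEdges
        ≡⟨ length-filter+length-filter-∁ (edge? G) allPairs ⟩
      length allPairs
        ≡⟨ length-allPairs ⟩
      n * n
        ∎

    positiveExamples-cover : All (IsVertexCover G) positiveExamples
    positiveExamples-cover =
      map⁺ (All.map (non-edge⇒∁⁅u,v⁆-cover G) (all-filter (∁? (edge? G)) allPairs))

    negativeExamples-noncover : All (λ S → ¬ IsVertexCover G S) negativeExamples
    negativeExamples-noncover =
      map⁺ (All.map (λ uv cover → ∁⁅u,v⁆-cover⇒non-edge G cover uv) (all-filter (edge? G) allPairs))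

    positive-consistent⇒⊆ᴱ : ∀ H → All (IsVertexCover H) positiveExamples → H ⊆ᴱ G
    positive-consistent⇒⊆ᴱ H covers u v uv = decidable-stable (adj G u v ≟ true) λ ¬uv →
      ∁⁅u,v⁆-cover⇒non-edge H
        (All.lookup covers (∈-map⁺ _ (∈-filter⁺ (∁? (edge? G)) ∈-allPairs ¬uv))) uv

    negative-consistent⇒⊇ᴱ : ∀ H → All (λ S → ¬ IsVertexCover H S) negativeExamples → G ⊆ᴱ H
    negative-consistent⇒⊇ᴱ H noncovers u v uv = decidable-stable (adj H u v ≟ true) λ ¬uv →
      All.lookup noncovers (∈-map⁺ _ (∈-filter⁺ (edge? G) ∈-allPairs uv))
        (non-edge⇒∁⁅u,v⁆-cover H ¬uv)

theorem3p1 : Σ ℕ λ c → Σ ℕ λ n₀ → ∀ n → n₀ ≤ n → (G : Graph n) →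
    Σ (List (Subset n)) λ P → Σ (List (Subset n)) λ N →
      (length P + length N ≤ c * (n * n))
      × All (IsVertexCover G) P
      × All (λ S → ¬ IsVertexCover G S) N
      × ((H : Graph n) → Consistent H P N → VC-Equivalent G H)
theorem3p1 = 1 , 0 , λ n _ G →
  positiveExamples G , negativeExamples G ,
  ≤-reflexive (trans (length-examples G) (≡.sym (*-identityˡ (n * n)))) ,
  positiveExamples-cover G ,
  negativeExamples-noncover G ,
  λ H (covers , noncovers) → same-edges⇒VC-Equivalent G H
    (positive-consistent⇒⊆ᴱ G H covers) (negative-consistent⇒⊇ᴱ G H noncovers)
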